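{- Let $G$ be an instance of the standard stable matching problem with quotas (as in the context), let $M$ be the $\mathcal{A}$-optimal stable matching of $G$ and let $M'$ be any stable matching of $G$. Then $\mathcal{A}_u(M')\subseteq\mathcal{A}_u(M)$.
   Context: An instance $G=(\mathcal{A}\cup\mathcal{B},E)$ has agents $\mathcal{A}$, programs $\mathcal{B}$, edges $E$ between mutually acceptable pairs, strict preference lists for each agent and each program over its neighbours ($y>_x z$: $x$ prefers $y$ to $z$), and an upper quota $q(p)$ for each program. A matching $M\subseteq E$ gives each agent at most one program and each program $p$ at most $q(p)$ agents; $M(a)$, $M(p)$ denote partners. $p$ is under-subscribed if $|M(p)|<q(p)$. A pair $(a,p)\in E\setminus M$ blocks $M$ if $p>_a M(a)$ (any acceptable program is preferred to being unmatched) and either $p$ is under-subscribed or some $a'\in M(p)$ has $a>_p a'$; $M$ is stable if there is no blocking pair. The $\mathcal{A}$-optimal stable matching is the stable matching in which every agent is matched to its most-preferred partner among all its partners in stable matchings. Let $\mathcal{A}_u$ be the set of agents unmatched in a stable matching $M$ (this set is the same for all stable matchings). For a program $p$, $\mathrm{Barrier}(p)$ is the agent most preferred by $p$ among the agents $a$ matched in $M$ with $p>_a M(a)$ (if no such agent exists, $\mathrm{Barrier}(p)$ is undefined). Let $E_M$ be the set of edges of $E$ incident to agents of $\mathcal{A}_u$, and delete from $E_M$ every edge $(a,p)$ with $a\in\mathcal{A}_u$ such that $\mathrm{Barrier}(p)$ is defined and $\mathrm{Barrier}(p)>_p a$. Then $\mathcal{A}_u(M)$ is the set of agents of $\mathcal{A}_u$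 that still have at least one incident edge in $E_M$. -}

module Defs where

open import Data.Nat using (ℕ; _<_; _≤_)
open import Data.Fin using (Fin) renaming (_≟_ to _≟F_)
open import Data.Bool using (Bool; T; true; false)
open import Data.Maybe using (Maybe; just; nothing)
open import Data.List using (length; filter) renaming (allFin to allFinL)
open import Data.Product using (Σ; _×_; _,_)
open import Data.Sum using (_⊎_)
open import Data.Empty using (⊥)
open import Data.Unit using (⊤)
open import Relation.Nullary using (¬_; Dec; yes; no)
open import Relation.Binary.PropositionalEquality using (_≡_; _≢_)

-- An instance: agents Fin nA, programs Fin nB, acceptability (edges) E,
-- strict preference lists encoded as ranks (smaller rank = more preferred),
-- required to be injective on the neighbourhood, and quotas q.
record Instance : Set where
  field
    nA nB  : ℕ
    E      : Fin nA → Fin nB → Bool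
    rankA  : Fin nA → Fin nB → ℕ
    rankB  : Fin nB → Fin nA → ℕ
    rankA-strict : ∀ a p p′ → T (E a p) → T (E a p′) → rankA a p ≡ rankA a p′ → p ≡ p′
    rankB-strict : ∀ p a a′ → T (E a p) → T (E a′ p) → rankB p a ≡ rankB p a′ → a ≡ a′
    q      : Fin nB → ℕ

module _ (I : Instance) where
  open Instance I

  Agent   = Fin nA
  Program = Fin nB

  Assignment : Set
  Assignment = Agent → Maybe Program

  isAssignedTo : Assignment → Agent → Program → Bool
  isAssignedTo M a p with M a
  ... | nothing = false
  ... | just p′ with p ≟F p′
  ...   | yes _ = true
  ...   | no _  = false

  load : Assignment → Program → ℕ
  load M p = length (filter (λ a → T? (isAssignedTo M a p)) (allFinL nA))
    where
      T? : (b : Bool) → Dec (T b)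
      T? true  = yes _
      T? false = no (λ z → z)

  IsMatching : Assignment → Set
  IsMatching M = (∀ a p → M a ≡ just p → T (E a p)) × (∀ p → load M p ≤ q p)

  PrefA : Agent → Program → Maybe Program → Set
  PrefA a p nothing   = T (E a p)
  PrefA a p (just p′) = T (E a p) × rankA a p < rankA a p′

  PrefB : Program → Agent → Agent → Set
  PrefB p a a′ = rankB p a < rankB p a′

  UnderSubscribed : Assignment → Program → Set
  UnderSubscribed M p = load M p < q p

  Blocking : Assignment → Agent → Program → Set
  Blocking M a p =
    T (E a p) × M a ≢ just p × PrefA a p (M a) ×
    (UnderSubscribed M p ⊎ Σ Agent (λ a′ → M a′ ≡ just p × PrefB p a a′))

  Stable : Assignment → Set
  Stable M = IsMatching M × (∀ a p → ¬ Blocking M a p)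

  WeaklyPrefA : Agent → Maybe Program → Maybe Program → Set
  WeaklyPrefA a m nothing            = ⊤
  WeaklyPrefA a nothing (just p′)    = ⊥
  WeaklyPrefA a (just p) (just p′)   = rankA a p ≤ rankA a p′

  AOptimal : Assignment → Set
  AOptimal M = Stable M × (∀ M′ → Stable M′ → ∀ a → WeaklyPrefA a (M a) (M′ a))

  BarrierCandidate : Assignment → Program → Agent → Set
  BarrierCandidate M p b = Σ Program (λ pb → M b ≡ just pb) × PrefA b p (M b)

  IsBarrier : Assignment → Program → Agent → Set
  IsBarrier M p b =
    BarrierCandidate M p b × (∀ b′ → BarrierCandidate M p b′ → b′ ≢ b → PrefB p b b′)

  InEM : Assignment → Agent → Program → Set
  InEM M a p = M a ≡ nothing × T (E a p) ×
               ¬ (Σ Agent (λ b → IsBarrier M p b × PrefB p b a))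

  AuM : Assignment → Agent → Set
  AuM M a = M a ≡ nothing × Σ Program (λ p → InEM M a p)

-- Rural hospitals for the A-optimal matching M: every program is at least as full in a
-- stable M′ as in M (an agent leaving p would block M′ at the under-subscribed p), and no
-- agent is matched in M′ but not in M, so counting matched agents both ways shows that
-- M and M′ match the same agents. An agent b matched in both with p >_b M(b) then has
-- p >_b M′(b), hence Barrier(p) in M′ is at least as good for p as Barrier(p) in M, and
-- every edge of E_{M′} survives in E_M.
module Submission where

open import Defs
open import Data.Nat.Properties
  using ( +-0-commutativeMonoid; ≤-totalOrder; _<?_; ≤-refl; ≤-antisym; ≤-<-trans; <-≤-trans
        ; ≮⇒≥; <⇒≱; ≤∧≢⇒<; 0≢1+n; +-mono-≤; +-mono-<-≤; +-mono-≤-<; module ≤-Reasoning)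
open import Algebra.Properties.CommutativeMonoid.Sum +-0-commutativeMonoid
  using (sum; sum-syntax; ∑-comm; sum-cong-≗; sum-replicate-zero)
open import Data.Bool.Base using (Bool; true; false; T)
open import Data.Bool.Properties using (T?)
open import Data.Empty using (⊥-elim)
open import Data.Fin.Base using (Fin; zero; suc)
open import Data.Fin.Properties using (_≟_)
open import Data.List.Base using (List; length; filter; tabulate; allFin)
import Data.List.Extrema ≤-totalOrder as Extrema
open import Data.List.Membership.Propositional.Properties using (∈-filter⁺; ∈-allFin)
open import Data.List.Relation.Unary.All using (lookup)
open import Data.List.Relation.Unary.All.Properties using (all-filter)
open import Data.Maybe.Base using (Maybe; just; nothing; is-just)
open import Data.Maybe.Properties using (≡-dec)
open import Data.Nat.Base using (ℕ; zero; suc; _≤_; _<_; z≤n)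
open import Data.Product using (∃; _×_; _,_; proj₁; proj₂)
open import Data.Sum.Base using (inj₁)
open import Function.Base using (_∘_; id)
open import Level using (0ℓ)
open import Relation.Nullary using (Dec; yes; no; does; _×-dec_)
open import Relation.Nullary.Decidable using (map′)
open import Relation.Unary using (Pred; Decidable)
open import Relation.Binary.PropositionalEquality

indicator : Bool → ℕ
indicator true  = 1
indicator false = 0

∑-mono-≤ : ∀ {n} {f g : Fin n → ℕ} → (∀ i → f i ≤ g i) → sum f ≤ sum g
∑-mono-≤ {zero}  f≤g = z≤n
∑-mono-≤ {suc n} f≤g = +-mono-≤ (f≤g zero) (∑-mono-≤ (f≤g ∘ suc))

∑-mono-< : ∀ {n} {f g : Fin n → ℕ} → (∀ i → f i ≤ g i) → ∀ i → f i < g i → sum f < sum g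
∑-mono-< f≤g zero    fi<gi = +-mono-<-≤ fi<gi (∑-mono-≤ (f≤g ∘ suc))
∑-mono-< f≤g (suc i) fi<gi = +-mono-≤-< (f≤g zero) (∑-mono-< (f≤g ∘ suc) i fi<gi)

∑-mono-≤-equality : ∀ {n} {f g : Fin n → ℕ} → (∀ i → f i ≤ g i) → sum g ≤ sum f →
                    ∀ i → f i ≡ g i
∑-mono-≤-equality f≤g ∑g≤∑f i =
  ≤-antisym (f≤g i) (≮⇒≥ λ fi<gi → <⇒≱ (∑-mono-< f≤g i fi<gi) ∑g≤∑f)

∑-indicator-≟ : ∀ {n} (j : Fin n) → ∑[ i < n ] indicator (does (i ≟ j)) ≡ 1
∑-indicator-≟ {suc n} zero    = cong suc (sum-replicate-zero n)
∑-indicator-≟ {suc n} (suc j) = ∑-indicator-≟ j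

length-filter-tabulate : ∀ {A : Set} (b : A → Bool) (b? : ∀ x → Dec (T (b x))) {n} (f : Fin n → A) →
                         length (filter b? (tabulate f)) ≡ ∑[ i < n ] indicator (b (f i))
length-filter-tabulate b b? {zero}  f = refl
length-filter-tabulate b b? {suc n} f with b (f zero) | b? (f zero)
... | true  | yes _ = cong suc (length-filter-tabulate b b? (f ∘ suc))
... | true  | no ¬t = ⊥-elim (¬t _)
... | false | yes ()
... | false | no _  = length-filter-tabulate b b? (f ∘ suc)

least-witness : ∀ {n} {C : Pred (Fin n) 0ℓ} → Decidable C → (r : Fin n → ℕ) → ∀ {x} → C x →
                ∃ λ y → C y × (∀ z → C z → r y ≤ r z)
least-witness {n} C? r {x} Cx =
    y
  , Extrema.argmin-all r Cx (all-filter C? (allFin n))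
  , λ z Cz → lookup (Extrema.f[argmin]≤f[xs] x witnesses) (∈-filter⁺ C? (∈-allFin z) Cz)
  where
  witnesses : List (Fin n)
  witnesses = filter C? (allFin n)
  y : Fin n
  y = Extrema.argmin r x witnesses

module _ (I : Instance) where
  open Instance I

  _≟ₘ_ : (m m′ : Maybe (Program I)) → Dec (m ≡ m′)
  _≟ₘ_ = ≡-dec _≟_

  isAssignedTo-≟ : ∀ M a p → isAssignedTo I M a p ≡ does (just p ≟ₘ M a)
  isAssignedTo-≟ M a p with M a
  ... | nothing = refl
  ... | just p′ with p ≟ p′
  ...   | yes _ = refl
  ...   | no _  = refl

  load≡∑ : ∀ M p → load I M p ≡ ∑[ a < nA ] indicator (does (just p ≟ₘ M a))
  load≡∑ M p = trans (length-filter-tabulate (λ a → isAssignedTo I M a p) _ id)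
    (sum-cong-≗ λ a → cong indicator (isAssignedTo-≟ M a p))

  size : Assignment I → ℕ
  size M = ∑[ a < nA ] indicator (is-just (M a))

  ∑-indicator-partner : ∀ (m : Maybe (Program I)) →
                        ∑[ p < nB ] indicator (does (just p ≟ₘ m)) ≡ indicator (is-just m)
  ∑-indicator-partner nothing   = sum-replicate-zero nB
  ∑-indicator-partner (just p₀) = ∑-indicator-≟ p₀

  ∑-load≡size : ∀ M → ∑[ p < nB ] load I M p ≡ size M
  ∑-load≡size M = begin
    ∑[ p < nB ] load I M p                                      ≡⟨ sum-cong-≗ (load≡∑ M) ⟩
    ∑[ p < nB ] ∑[ a < nA ] indicator (does (just p ≟ₘ M a))  ≡⟨ ∑-comm (λ p a → indicator (does (just p ≟ₘ M a))) ⟩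
    ∑[ a < nA ] ∑[ p < nB ] indicator (does (just p ≟ₘ M a))  ≡⟨ sum-cong-≗ (∑-indicator-partner ∘ M) ⟩
    size M                                                      ∎
    where open ≡-Reasoning

  acceptable : ∀ {N} → Stable I N → ∀ {a p} → N a ≡ just p → T (E a p)
  acceptable ((edges , _) , _) = edges _ _

  candidate-acceptable : ∀ {N p b} → BarrierCandidate I N p b → T (E b p)
  candidate-acceptable ((_ , Nb≡pb) , pref) rewrite Nb≡pb = proj₁ pref

  barrierCandidate? : ∀ N p → Decidable (BarrierCandidate I N p)
  barrierCandidate? N p b with N b
  ... | nothing = no λ { ((_ , ()) , _) }
  ... | just pb = map′ ((pb , refl) ,_) proj₂ (T? (E b p) ×-dec rankA b p <? rankA b pb)

  barrier-exists : ∀ N p {b} → BarrierCandidate I N p b →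
                   ∃ λ b* → IsBarrier I N p b* × rankB p b* ≤ rankB p b
  barrier-exists N p cand with least-witness (barrierCandidate? N p) (rankB p) cand
  ... | b* , cand* , least = b* , (cand* , strictly-least) , least _ cand
    where
    strictly-least : ∀ b′ → BarrierCandidate I N p b′ → b′ ≢ b* → PrefB I p b* b′
    strictly-least b′ cand′ b′≢b* = ≤∧≢⇒< (least b′ cand′) λ same-rank →
      b′≢b* (sym (rankB-strict p b* b′ (candidate-acceptable {N} cand*)
                                         (candidate-acceptable {N} cand′) same-rank))

  module _ (M M′ : Assignment I) (optimal : AOptimal I M) (stable′ : Stable I M′) where

    stable : Stable I M
    stable = proj₁ optimal

    weakly-prefers : ∀ a → WeaklyPrefA I a (M a) (M′ a)
    weakly-prefers = proj₂ optimal M′ stable′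

    prefers-optimal : ∀ {a p} → M a ≡ just p → M′ a ≢ just p → PrefA I a p (M′ a)
    prefers-optimal {a} {p} Ma≡p M′a≢p with M′ a in M′a≡p′ | weakly-prefers a
    ... | nothing | _ = acceptable stable Ma≡p
    ... | just p′ | p≤p′ rewrite Ma≡p = acceptable stable Ma≡p , ≤∧≢⇒< p≤p′ λ same-rank →
      M′a≢p (cong just (sym (rankA-strict a p p′ (acceptable stable Ma≡p)
                                                 (acceptable stable′ M′a≡p′) same-rank)))

    load-mono : ∀ p → load I M p ≤ load I M′ p
    load-mono p = ≮⇒≥ λ fewer′ → <⇒≱ fewer′ (subst₂ _≤_ (sym (load≡∑ M p)) (sym (load≡∑ M′ p))
                                                        (∑-mono-≤ (stays fewer′)))
      where
      -- p is under-subscribed in M′, so an agent of M(p) outside M′(p) would block M′.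
      stays : load I M′ p < load I M p →
              ∀ a → indicator (does (just p ≟ₘ M a)) ≤ indicator (does (just p ≟ₘ M′ a))
      stays fewer′ a with just p ≟ₘ M a | just p ≟ₘ M′ a
      ... | no _     | _        = z≤n
      ... | yes _    | yes _    = ≤-refl
      ... | yes p≡Ma | no p≢M′a = ⊥-elim (proj₂ stable′ a p
        ( acceptable stable (sym p≡Ma) , p≢M′a ∘ sym , prefers-optimal (sym p≡Ma) (p≢M′a ∘ sym)
        , inj₁ (<-≤-trans fewer′ (proj₂ (proj₁ stable) p))))

    matched-mono : ∀ a → indicator (is-just (M′ a)) ≤ indicator (is-just (M a))
    matched-mono a with M′ a | M a | weakly-prefers a
    ... | nothing | _       | _  = z≤n
    ... | just _  | just _  | _  = ≤-refl
    ... | just _  | nothing | ()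

    matched-same : ∀ a → indicator (is-just (M′ a)) ≡ indicator (is-just (M a))
    matched-same = ∑-mono-≤-equality matched-mono (begin
      size M                    ≡⟨ ∑-load≡size M ⟨
      ∑[ p < nB ] load I M p    ≤⟨ ∑-mono-≤ load-mono ⟩
      ∑[ p < nB ] load I M′ p   ≡⟨ ∑-load≡size M′ ⟩
      size M′                   ∎)
      where open ≤-Reasoning

    unmatched-optimal : ∀ {a} → M′ a ≡ nothing → M a ≡ nothing
    unmatched-optimal {a} M′a≡ with M a | matched-same a
    ... | nothing | _ = refl
    ... | just _  | same rewrite M′a≡ = ⊥-elim (0≢1+n same)

    candidate-transfer : ∀ {p b} → BarrierCandidate I M p b → BarrierCandidate I M′ p b
    candidate-transfer {b = b} ((pb , Mb≡pb) , pref) with M′ b | matched-same b | weakly-prefers b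
    ... | nothing  | same | _       rewrite Mb≡pb = ⊥-elim (0≢1+n same)
    ... | just pb′ | _    | pb≤pb′ rewrite Mb≡pb =
      (pb′ , refl) , proj₁ pref , <-≤-trans (proj₂ pref) pb≤pb′

    barrier-transfer : ∀ {p b} → IsBarrier I M p b →
                       ∃ λ b* → IsBarrier I M′ p b* × rankB p b* ≤ rankB p b
    barrier-transfer (cand , _) = barrier-exists M′ _ (candidate-transfer cand)

lemma1 : (I : Instance) (M M′ : Assignment I) →
         AOptimal I M → Stable I M′ →
         ∀ a → AuM I M′ a → AuM I M a
lemma1 I M M′ optimal stable′ a (unmatched′ , p , _ , edge , no-barrier′) =
  unmatched , p , unmatched , edge , λ (b , barrier , b>a) →
    let b* , barrier* , b*≥b = barrier-transfer I M M′ optimal stable′ barrier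
    in no-barrier′ (b* , barrier* , ≤-<-trans b*≥b b>a)
  where
  unmatched : M a ≡ nothing
  unmatched = unmatched-optimal I M M′ optimal stable′ unmatched′
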